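{- For an index $(k_1,\dots,k_r)$ with $k_1+\dots+k_r$ even, \[I_2(k_1,\dots,k_r)+{}_1I_1(k_1,\dots,k_r)+I_2(k_r,\dots,k_1)=\sigma_2(I_0(k_1,\dots,k_r)).\]
   Context: An index is a finite sequence of positive integers, including $\emptyset$; $\mathcal{I}$ is the $\mathbb{Q}$-vector space with basis the indices. The harmonic product $*$ on $\mathcal{I}$ is bilinear with $\emptyset*\boldsymbol{k}=\boldsymbol{k}*\emptyset=\boldsymbol{k}$ and $(\boldsymbol{k},k)*(\boldsymbol{l},l)=(\boldsymbol{k}*(\boldsymbol{l},l),k)+((\boldsymbol{k},k)*\boldsymbol{l},l)+(\boldsymbol{k}*\boldsymbol{l},k+l)$. For $n\ge0$, $\sigma_n$ is the linear map $\sigma_n(k_1,\dots,k_r)=\sum_{l_1+\dots+l_r=n,\ l_i\ge0}(k_1+l_1,\dots,k_r+l_r)\prod_i\binom{k_i+l_i-1}{l_i}$, $\sigma_n(\emptyset)=\delta_{n,0}$. For $m,n\ge0$, ${}_mI_n(k_1,\dots,k_r)=\sum_{i=0}^r(-1)^{k_r+\dots+k_{i+1}}\sigma_m(k_1,\dots,k_i)*\sigma_n(k_r,\dots,k_{i+1})$ (extended linearly), and $I_n:={}_0I_n$. -}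

module Defs where

open import Data.Nat using (ℕ; zero; suc; _+_; _∸_; _≟_)
open import Data.Nat.Combinatorics using (_C_)
open import Data.List using (List; []; _∷_; _++_; map; concatMap; reverse; take; drop; upTo; length)
open import Data.Nat.ListAction using (sum)
open import Data.List.Properties using (≡-dec)
open import Data.Product using (_×_; _,_)
open import Data.Integer using (+_)
open import Data.Rational using (ℚ; 0ℚ; 1ℚ; -_; _/_) renaming (_+_ to _+ℚ_; _*_ to _*ℚ_)
open import Relation.Binary.PropositionalEquality using (_≡_)
open import Relation.Nullary using (yes; no)

-- An index is represented as a list of natural numbers; positivity of the
-- entries is imposed as a hypothesis in the statement.
Index : Set
Index = List ℕ

-- An element of the Q-vector space 𝓘: a finite formal Q-linear combination
-- of indices, written as a list of (coefficient, index) pairs.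
Lin : Set
Lin = List (ℚ × Index)

coeff : Lin → Index → ℚ
coeff [] w = 0ℚ
coeff ((c , v) ∷ x) w with ≡-dec _≟_ v w
... | yes _ = c +ℚ coeff x w
... | no _  = coeff x w

infix 4 _≈_
_≈_ : Lin → Lin → Set
x ≈ y = ∀ w → coeff x w ≡ coeff y w

⟦_⟧ : Index → Lin
⟦ w ⟧ = (1ℚ , w) ∷ []

_·_ : ℚ → Lin → Lin
a · x = map (λ { (c , w) → (a *ℚ c , w) }) x

fromℕℚ : ℕ → ℚ
fromℕℚ n = (+ n) / 1

-- Harmonic product on reversed words (head = last entry):
-- (k,a)*(l,b) = ((a)*(l,b), k) + ((k,a)*b, l) + (a*b, k+l)
harmRev : Index → Index → List Index
harmRev [] v = v ∷ []
harmRev (k ∷ a) [] = (k ∷ a) ∷ []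
harmRev (k ∷ a) (l ∷ b) =
  map (k ∷_) (harmRev a (l ∷ b)) ++
  (map (l ∷_) (harmRev (k ∷ a) b) ++
  map ((k + l) ∷_) (harmRev a b))

harmIdx : Index → Index → Lin
harmIdx u v = map (λ w → (1ℚ , reverse w)) (harmRev (reverse u) (reverse v))

infixl 7 _✶_
_✶_ : Lin → Lin → Lin
x ✶ y = concatMap (λ { (a , u) → concatMap (λ { (b , v) → (a *ℚ b) · harmIdx u v }) y }) x

-- σ_n on an index:
-- σ_n(k_1..k_r) = Σ_{l_1+..+l_r=n} Π binom(k_i+l_i-1, l_i) (k_1+l_1,...,k_r+l_r)
σIdx : ℕ → Index → Lin
σIdx zero [] = ⟦ [] ⟧
σIdx (suc n) [] = []
σIdx n (k ∷ ks) =
  concatMap (λ l → map (λ { (c , w) → (fromℕℚ ((k + l ∸ 1) C l) *ℚ c , (k + l) ∷ w) })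
                       (σIdx (n ∸ l) ks))
            (upTo (suc n))

σ : ℕ → Lin → Lin
σ n x = concatMap (λ { (c , w) → c · σIdx n w }) x

sgn : ℕ → ℚ
sgn zero = 1ℚ
sgn (suc m) = - sgn m

-- _m I_n (k_1..k_r) = Σ_{i=0}^r (-1)^{k_{i+1}+..+k_r} σ_m(k_1..k_i) * σ_n(k_r..k_{i+1})
mIn : ℕ → ℕ → Index → Lin
mIn m n ks =
  concatMap (λ i → sgn (sum (drop i ks)) ·
                   (σIdx m (take i ks) ✶ σIdx n (reverse (drop i ks))))
            (upTo (suc (length ks)))

I : ℕ → Index → Lin
I n = mIn 0 n

{-# OPTIONS --safe #-}
-- σ₁ raises one entry k of an index to k + 1 with weight k. It is a derivation of the
-- harmonic product: in the recursion on last letters, the merged letter k + l carries the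
-- weight k + l, the sum of the weights of k and l. Since 2·C(k+1, 2) = k(k+1), moreover
-- σ₁ ∘ σ₁ = 2σ₂, hence
--   σ₂(x * y) = x * σ₂ y + σ₁ x * σ₁ y + σ₂ x * y.
-- Applied to the i-th term ±σ₀(k₁,…,kᵢ) * σ₀(kᵣ,…,kᵢ₊₁) of I₀, the three summands are the
-- i-th terms of I₂(k₁,…,kᵣ) and ₁I₁(k₁,…,kᵣ) and, by commutativity of *, the (r−i)-th term
-- of I₂(kᵣ,…,k₁), whose sign (−1)^(k₁+…+kᵢ) is (−1)^(kᵢ₊₁+…+kᵣ) because the weight is even.
module Submission where

open import Defs
open import Level using (0ℓ)
open import Data.Nat using (ℕ; zero; suc; _+_; _*_; _∸_; _≤_; _≟_)
import Data.Nat.Properties as ℕ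
open import Data.Nat.Combinatorics using (_C_; nC1≡n; nCk+nC[k+1]≡[n+1]C[k+1])
open import Data.Nat.Divisibility using (_∣_; divides)
open import Data.Nat.ListAction using (sum)
open import Data.Nat.ListAction.Properties using (sum-++; sum-↭)
import Data.Integer as ℤ
open import Data.Integer using (1ℤ)
import Data.Integer.Properties as ℤ
open import Data.Integer.Tactic.RingSolver using (solve-∀)
open import Data.Rational using (ℚ; 0ℚ; 1ℚ; ½; -_; toℚᵘ) renaming (_+_ to _+ℚ_; _*_ to _*ℚ_)
open import Data.Rational.Properties
  using (toℚᵘ-injective; toℚᵘ-fromℚᵘ; toℚᵘ-homo-+; toℚᵘ-homo-*; neg-distribˡ-*;
         +-identityˡ; +-identityʳ; +-assoc; +-comm;
         *-identityˡ; *-identityʳ; *-zeroˡ; *-zeroʳ; *-distribˡ-+; *-distribʳ-+; *-assoc; *-comm)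
open import Data.Rational.Solver using (module +-*-Solver)
open import Data.Rational.Unnormalised using (mkℚᵘ; *≡*) renaming (_≃_ to _≃ᵘ_; _+_ to _+ᵘ_; _*_ to _*ᵘ_)
import Data.Rational.Unnormalised.Properties as ℚᵘ
open import Data.List using (List; []; _∷_; _++_; _∷ʳ_; map; concatMap; reverse; take; drop; length; applyUpTo; deduplicate)
open import Data.List.Properties
  using (≡-dec; map-++; concatMap-++; ++-assoc; ++-identityʳ; reverse-++; reverse-involutive; unfold-reverse;
         length-reverse; length-drop; take++drop≡id)
open import Data.List.Membership.Propositional using (_∈_)
open import Data.List.Membership.Propositional.Properties using (∈-++⁺ˡ; ∈-++⁺ʳ; ∈-deduplicate⁺)
open import Data.List.Relation.Binary.Permutation.Propositional.Properties using (↭-reverse)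
open import Data.List.Relation.Unary.All as All using (All; []; _∷_)
open import Data.List.Relation.Unary.Any using (here; there)
open import Data.List.Relation.Unary.Unique.Propositional using (Unique; _∷_)
open import Data.List.Relation.Unary.Unique.DecPropositional.Properties (≡-dec _≟_) using (deduplicate-!)
open import Data.List.Reverse using (Reverse; []; _∶_∶ʳ_; reverseView)
open import Data.Product using (_,_; proj₁; proj₂)
open import Function using (_∘_; id; flip)
open import Relation.Binary.Bundles using (Setoid)
open import Relation.Binary.Definitions using (DecidableEquality)
open import Relation.Binary.Structures using (IsEquivalence)
open import Relation.Binary.PropositionalEquality
  using (_≡_; _≢_; refl; sym; trans; cong; cong₂; subst; ≢-sym; module ≡-Reasoning)
open import Relation.Nullary using (yes; no; contradiction)
import Relation.Binary.Reasoning.Setoid as SetoidReasoning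

open +-*-Solver using (solve; _:+_; _:*_; _:=_; con)

toℚᵘ-fromℕℚ : ∀ n → toℚᵘ (fromℕℚ n) ≃ᵘ mkℚᵘ (ℤ.+ n) 0
toℚᵘ-fromℕℚ n = toℚᵘ-fromℚᵘ (mkℚᵘ (ℤ.+ n) 0)

fromℕℚ-+ : ∀ m n → fromℕℚ (m + n) ≡ fromℕℚ m +ℚ fromℕℚ n
fromℕℚ-+ m n = toℚᵘ-injective (begin
  toℚᵘ (fromℕℚ (m + n))                ≈⟨ toℚᵘ-fromℕℚ (m + n) ⟩
  mkℚᵘ (ℤ.+ (m + n)) 0                 ≈⟨ *≡* (trans (cong (ℤ._* 1ℤ) (ℤ.pos-+ m n)) (identity (ℤ.+ m) (ℤ.+ n))) ⟩
  mkℚᵘ (ℤ.+ m) 0 +ᵘ mkℚᵘ (ℤ.+ n) 0     ≈⟨ ℚᵘ.+-cong (toℚᵘ-fromℕℚ m) (toℚᵘ-fromℕℚ n) ⟨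
  toℚᵘ (fromℕℚ m) +ᵘ toℚᵘ (fromℕℚ n)   ≈⟨ toℚᵘ-homo-+ (fromℕℚ m) (fromℕℚ n) ⟨
  toℚᵘ (fromℕℚ m +ℚ fromℕℚ n)          ∎)
  where
  open ℚᵘ.≃-Reasoning
  identity : ∀ a b → (a ℤ.+ b) ℤ.* 1ℤ ≡ (a ℤ.* 1ℤ ℤ.+ b ℤ.* 1ℤ) ℤ.* 1ℤ
  identity = solve-∀

fromℕℚ-* : ∀ m n → fromℕℚ (m * n) ≡ fromℕℚ m *ℚ fromℕℚ n
fromℕℚ-* m n = toℚᵘ-injective (begin
  toℚᵘ (fromℕℚ (m * n))                ≈⟨ toℚᵘ-fromℕℚ (m * n) ⟩
  mkℚᵘ (ℤ.+ (m * n)) 0                 ≈⟨ *≡* (cong (ℤ._* 1ℤ) (ℤ.pos-* m n)) ⟩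
  mkℚᵘ (ℤ.+ m) 0 *ᵘ mkℚᵘ (ℤ.+ n) 0     ≈⟨ ℚᵘ.*-cong (toℚᵘ-fromℕℚ m) (toℚᵘ-fromℕℚ n) ⟨
  toℚᵘ (fromℕℚ m) *ᵘ toℚᵘ (fromℕℚ n)   ≈⟨ toℚᵘ-homo-* (fromℕℚ m) (fromℕℚ n) ⟨
  toℚᵘ (fromℕℚ m *ℚ fromℕℚ n)          ∎)
  where open ℚᵘ.≃-Reasoning

sgn-+ : ∀ m n → sgn (m + n) ≡ sgn m *ℚ sgn n
sgn-+ zero    n = sym (*-identityˡ (sgn n))
sgn-+ (suc m) n = trans (cong -_ (sgn-+ m n)) (neg-distribˡ-* (sgn m) (sgn n))

sgn-*2 : ∀ q → sgn (q * 2) ≡ 1ℚ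
sgn-*2 zero    = refl
sgn-*2 (suc q) = trans (sgn-+ 2 (q * 2)) (trans (*-identityˡ _) (sgn-*2 q))

sgn-even : ∀ {n} → 2 ∣ n → sgn n ≡ 1ℚ
sgn-even (divides q refl) = sgn-*2 q

sgn-square : ∀ n → sgn n *ℚ sgn n ≡ 1ℚ
sgn-square n = trans (sym (sgn-+ n n)) (sgn-even (divides n n+n≡n*2))
  where
  n+n≡n*2 : n + n ≡ n * 2
  n+n≡n*2 = trans (cong (n +_) (sym (ℕ.+-identityʳ n))) (ℕ.*-comm 2 n)

2∣m+n⇒sgn[m]≡sgn[n] : ∀ m n → 2 ∣ m + n → sgn m ≡ sgn n
2∣m+n⇒sgn[m]≡sgn[n] m n 2∣m+n = begin
  sgn m                      ≡⟨ *-identityʳ (sgn m) ⟨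
  sgn m *ℚ 1ℚ                ≡⟨ cong (sgn m *ℚ_) (sgn-even 2∣m+n) ⟨
  sgn m *ℚ sgn (m + n)       ≡⟨ cong (sgn m *ℚ_) (sgn-+ m n) ⟩
  sgn m *ℚ (sgn m *ℚ sgn n)  ≡⟨ *-assoc (sgn m) (sgn m) (sgn n) ⟨
  (sgn m *ℚ sgn m) *ℚ sgn n  ≡⟨ cong (_*ℚ sgn n) (sgn-square m) ⟩
  1ℚ *ℚ sgn n                ≡⟨ *-identityˡ (sgn n) ⟩
  sgn n                      ∎
  where open ≡-Reasoning

_≟ᵢ_ : DecidableEquality Index
_≟ᵢ_ = ≡-dec _≟_

-- Defs' _≈_ wrapped in a record, so that both sides can be inferred.
infix 4 _≋_
record _≋_ (x y : Lin) : Set where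
  constructor mk≋
  field coeff-≡ : ∀ w → coeff x w ≡ coeff y w
open _≋_ public

≋-isEquivalence : IsEquivalence _≋_
≋-isEquivalence = record
  { refl  = mk≋ λ _ → refl
  ; sym   = λ x≋y → mk≋ λ w → sym (coeff-≡ x≋y w)
  ; trans = λ x≋y y≋z → mk≋ λ w → trans (coeff-≡ x≋y w) (coeff-≡ y≋z w)
  }

≋-setoid : Setoid 0ℓ 0ℓ
≋-setoid = record { isEquivalence = ≋-isEquivalence }

open IsEquivalence ≋-isEquivalence public
  using () renaming (refl to ≋-refl; sym to ≋-sym; trans to ≋-trans; reflexive to ≋-reflexive)

module ≋-Reasoning = SetoidReasoning ≋-setoid

coeff-++ : ∀ x y w → coeff (x ++ y) w ≡ coeff x w +ℚ coeff y w
coeff-++ []            y w = sym (+-identityˡ _)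
coeff-++ ((c , v) ∷ x) y w with v ≟ᵢ w
... | yes _ = trans (cong (c +ℚ_) (coeff-++ x y w)) (sym (+-assoc c _ _))
... | no  _ = coeff-++ x y w

coeff-· : ∀ a x w → coeff (a · x) w ≡ a *ℚ coeff x w
coeff-· a []            w = sym (*-zeroʳ a)
coeff-· a ((c , v) ∷ x) w with v ≟ᵢ w
... | yes _ = trans (cong (a *ℚ c +ℚ_) (coeff-· a x w)) (sym (*-distribˡ-+ a c _))
... | no  _ = coeff-· a x w

++-cong : ∀ {x x′ y y′} → x ≋ x′ → y ≋ y′ → x ++ y ≋ x′ ++ y′
++-cong {x} {x′} {y} {y′} x≋x′ y≋y′ = mk≋ λ w → begin
  coeff (x ++ y) w          ≡⟨ coeff-++ x y w ⟩
  coeff x w +ℚ coeff y w    ≡⟨ cong₂ _+ℚ_ (coeff-≡ x≋x′ w) (coeff-≡ y≋y′ w) ⟩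
  coeff x′ w +ℚ coeff y′ w  ≡⟨ coeff-++ x′ y′ w ⟨
  coeff (x′ ++ y′) w        ∎
  where open ≡-Reasoning

·-cong : ∀ a {x y} → x ≋ y → a · x ≋ a · y
·-cong a {x} {y} x≋y = mk≋ λ w → begin
  coeff (a · x) w     ≡⟨ coeff-· a x w ⟩
  a *ℚ coeff x w      ≡⟨ cong (a *ℚ_) (coeff-≡ x≋y w) ⟩
  a *ℚ coeff y w      ≡⟨ coeff-· a y w ⟨
  coeff (a · y) w     ∎
  where open ≡-Reasoning

++-comm : ∀ x y → x ++ y ≋ y ++ x
++-comm x y = mk≋ λ w →
  trans (coeff-++ x y w) (trans (+-comm (coeff x w) (coeff y w)) (sym (coeff-++ y x w)))

·-assoc : ∀ a b x → a · (b · x) ≋ (a *ℚ b) · x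
·-assoc a b x = mk≋ λ w → begin
  coeff (a · (b · x)) w     ≡⟨ coeff-· a (b · x) w ⟩
  a *ℚ coeff (b · x) w      ≡⟨ cong (a *ℚ_) (coeff-· b x w) ⟩
  a *ℚ (b *ℚ coeff x w)     ≡⟨ *-assoc a b (coeff x w) ⟨
  (a *ℚ b) *ℚ coeff x w     ≡⟨ coeff-· (a *ℚ b) x w ⟨
  coeff ((a *ℚ b) · x) w    ∎
  where open ≡-Reasoning

·-identityˡ : ∀ x → 1ℚ · x ≋ x
·-identityˡ x = mk≋ λ w → trans (coeff-· 1ℚ x w) (*-identityˡ (coeff x w))

·-zeroˡ : ∀ x → 0ℚ · x ≋ []
·-zeroˡ x = mk≋ λ w → trans (coeff-· 0ℚ x w) (*-zeroˡ (coeff x w))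

-- Combinations of fixed atoms; rearranging them is, coefficientwise, a ring identity in ℚ.
infixr 5 _⊕_
infixr 6 _⊙_
data Expr : Set where
  atom : Lin → Expr
  _⊕_  : Expr → Expr → Expr
  _⊙_  : ℚ → Expr → Expr

⟦_⟧ₑ : Expr → Lin
⟦ atom x ⟧ₑ = x
⟦ e ⊕ e′ ⟧ₑ = ⟦ e ⟧ₑ ++ ⟦ e′ ⟧ₑ
⟦ a ⊙ e ⟧ₑ  = a · ⟦ e ⟧ₑ

coeffₑ : Expr → Index → ℚ
coeffₑ (atom x) w = coeff x w
coeffₑ (e ⊕ e′) w = coeffₑ e w +ℚ coeffₑ e′ w
coeffₑ (a ⊙ e)  w = a *ℚ coeffₑ e w

coeff-⟦⟧ₑ : ∀ e w → coeff ⟦ e ⟧ₑ w ≡ coeffₑ e w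
coeff-⟦⟧ₑ (atom x) w = refl
coeff-⟦⟧ₑ (e ⊕ e′) w =
  trans (coeff-++ ⟦ e ⟧ₑ ⟦ e′ ⟧ₑ w) (cong₂ _+ℚ_ (coeff-⟦⟧ₑ e w) (coeff-⟦⟧ₑ e′ w))
coeff-⟦⟧ₑ (a ⊙ e)  w = trans (coeff-· a ⟦ e ⟧ₑ w) (cong (a *ℚ_) (coeff-⟦⟧ₑ e w))

⟦⟧ₑ-≋ : ∀ e e′ → (∀ w → coeffₑ e w ≡ coeffₑ e′ w) → ⟦ e ⟧ₑ ≋ ⟦ e′ ⟧ₑ
⟦⟧ₑ-≋ e e′ eq = mk≋ λ w → trans (coeff-⟦⟧ₑ e w) (trans (eq w) (sym (coeff-⟦⟧ₑ e′ w)))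

++-interchange : ∀ w x y z → (w ++ x) ++ (y ++ z) ≋ (w ++ y) ++ (x ++ z)
++-interchange w x y z = ⟦⟧ₑ-≋ ((atom w ⊕ atom x) ⊕ (atom y ⊕ atom z)) ((atom w ⊕ atom y) ⊕ (atom x ⊕ atom z))
  (λ v → solve 4 (λ a b c d → (a :+ b) :+ (c :+ d) := (a :+ c) :+ (b :+ d)) refl
                 (coeff w v) (coeff x v) (coeff y v) (coeff z v))

++-swapʳ : ∀ x y z → (x ++ y) ++ z ≋ (x ++ z) ++ y
++-swapʳ x y z = ⟦⟧ₑ-≋ ((atom x ⊕ atom y) ⊕ atom z) ((atom x ⊕ atom z) ⊕ atom y)
  (λ w → solve 3 (λ a b c → (a :+ b) :+ c := (a :+ c) :+ b) refl (coeff x w) (coeff y w) (coeff z w))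

++-exchange : ∀ x y z → x ++ (y ++ z) ≋ y ++ (x ++ z)
++-exchange x y z = ⟦⟧ₑ-≋ (atom x ⊕ (atom y ⊕ atom z)) (atom y ⊕ (atom x ⊕ atom z))
  (λ w → solve 3 (λ a b c → a :+ (b :+ c) := b :+ (a :+ c)) refl (coeff x w) (coeff y w) (coeff z w))

-- Linear extension and linear maps

pairing : Lin → (Index → ℚ) → ℚ
pairing []            g = 0ℚ
pairing ((c , u) ∷ x) g = c *ℚ g u +ℚ pairing x g

sumOver : List Index → (Index → ℚ) → ℚ
sumOver []      h = 0ℚ
sumOver (v ∷ D) h = h v +ℚ sumOver D h

sumOver-cong : ∀ D {g h} → (∀ v → g v ≡ h v) → sumOver D g ≡ sumOver D h
sumOver-cong []      g≗h = refl
sumOver-cong (v ∷ D) g≗h = cong₂ _+ℚ_ (g≗h v) (sumOver-cong D g≗h)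

sumOver-zero : ∀ {D} h → All (λ v → h v ≡ 0ℚ) D → sumOver D h ≡ 0ℚ
sumOver-zero h []           = refl
sumOver-zero h (h≡0 ∷ h≡0s) = trans (cong₂ _+ℚ_ h≡0 (sumOver-zero h h≡0s)) (+-identityˡ 0ℚ)

sumOver-+ : ∀ D g h → sumOver D (λ v → g v +ℚ h v) ≡ sumOver D g +ℚ sumOver D h
sumOver-+ []      g h = sym (+-identityˡ 0ℚ)
sumOver-+ (v ∷ D) g h = trans (cong (g v +ℚ h v +ℚ_) (sumOver-+ D g h))
                              (interchange (g v) (h v) (sumOver D g) (sumOver D h))
  where
  interchange : ∀ a b c d → (a +ℚ b) +ℚ (c +ℚ d) ≡ (a +ℚ c) +ℚ (b +ℚ d)
  interchange = solve 4 (λ a b c d → (a :+ b) :+ (c :+ d) := (a :+ c) :+ (b :+ d)) refl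

coeff-single-≡ : ∀ c u → coeff ((c , u) ∷ []) u ≡ c
coeff-single-≡ c u with u ≟ᵢ u
... | yes _   = +-identityʳ c
... | no  u≢u = contradiction refl u≢u

coeff-single-≢ : ∀ c {u v} → u ≢ v → coeff ((c , u) ∷ []) v ≡ 0ℚ
coeff-single-≢ c {u} {v} u≢v with u ≟ᵢ v
... | yes u≡v = contradiction u≡v u≢v
... | no  _   = refl

sumOver-single : ∀ c u (g : Index → ℚ) {D} → Unique D → u ∈ D →
                 sumOver D (λ v → coeff ((c , u) ∷ []) v *ℚ g v) ≡ c *ℚ g u
sumOver-single c u g (u∉D ∷ _) (here refl) =
  trans (cong₂ _+ℚ_ (cong (_*ℚ g u) (coeff-single-≡ c u)) (sumOver-zero _ (All.map vanish u∉D)))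
        (+-identityʳ (c *ℚ g u))
  where
  vanish : ∀ {v} → u ≢ v → coeff ((c , u) ∷ []) v *ℚ g v ≡ 0ℚ
  vanish {v} u≢v = trans (cong (_*ℚ g v) (coeff-single-≢ c u≢v)) (*-zeroˡ (g v))
sumOver-single c u g {d ∷ D} (d∉D ∷ uniq) (there u∈D) =
  trans (cong₂ _+ℚ_ (trans (cong (_*ℚ g d) (coeff-single-≢ c u≢d)) (*-zeroˡ (g d)))
                    (sumOver-single c u g uniq u∈D))
        (+-identityˡ (c *ℚ g u))
  where
  u≢d : u ≢ d
  u≢d = ≢-sym (All.lookup d∉D u∈D)

words : Lin → List Index
words = map proj₂

-- Over a duplicate-free D containing the support, pairing is visibly a function of the coefficients.
pairing-as-sumOver : ∀ x g {D} → Unique D → (∀ {u} → u ∈ words x → u ∈ D) →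
                     pairing x g ≡ sumOver D (λ v → coeff x v *ℚ g v)
pairing-as-sumOver []            g {D} _    _    = sym (sumOver-zero {D} _ (All.tabulate λ {v} _ → *-zeroˡ (g v)))
pairing-as-sumOver ((c , u) ∷ x) g {D} uniq x⊆D = begin
  c *ℚ g u +ℚ pairing x g
    ≡⟨ cong₂ _+ℚ_ (sym (sumOver-single c u g uniq (x⊆D (here refl))))
                  (pairing-as-sumOver x g uniq (x⊆D ∘ there)) ⟩
  sumOver D (λ v → coeff ((c , u) ∷ []) v *ℚ g v) +ℚ sumOver D (λ v → coeff x v *ℚ g v)
    ≡⟨ sumOver-+ D _ _ ⟨
  sumOver D (λ v → coeff ((c , u) ∷ []) v *ℚ g v +ℚ coeff x v *ℚ g v)
    ≡⟨ sumOver-cong D (λ v → trans (sym (*-distribʳ-+ (g v) (coeff ((c , u) ∷ []) v) (coeff x v)))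
                                      (cong (_*ℚ g v) (sym (coeff-++ ((c , u) ∷ []) x v)))) ⟩
  sumOver D (λ v → coeff ((c , u) ∷ x) v *ℚ g v)
    ∎
  where open ≡-Reasoning

pairing-cong : ∀ g {x y} → x ≋ y → pairing x g ≡ pairing y g
pairing-cong g {x} {y} x≋y = begin
  pairing x g                              ≡⟨ pairing-as-sumOver x g uniq (∈D ∘ ∈-++⁺ˡ) ⟩
  sumOver D (λ v → coeff x v *ℚ g v)       ≡⟨ sumOver-cong D (λ v → cong (_*ℚ g v) (coeff-≡ x≋y v)) ⟩
  sumOver D (λ v → coeff y v *ℚ g v)       ≡⟨ pairing-as-sumOver y g uniq (∈D ∘ ∈-++⁺ʳ (words x)) ⟨
  pairing y g                              ∎
  where
  open ≡-Reasoning
  D = deduplicate _≟ᵢ_ (words x ++ words y)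
  uniq : Unique D
  uniq = deduplicate-! (words x ++ words y)
  ∈D : ∀ {u} → u ∈ words x ++ words y → u ∈ D
  ∈D = ∈-deduplicate⁺ _≟ᵢ_

ext : (Index → Lin) → Lin → Lin
ext f = concatMap (λ p → proj₁ p · f (proj₂ p))

coeff-ext : ∀ f x w → coeff (ext f x) w ≡ pairing x (λ u → coeff (f u) w)
coeff-ext f []            w = refl
coeff-ext f ((c , u) ∷ x) w =
  trans (coeff-++ (c · f u) (ext f x) w) (cong₂ _+ℚ_ (coeff-· c (f u) w) (coeff-ext f x w))

ext-cong : ∀ f {x y} → x ≋ y → ext f x ≋ ext f y
ext-cong f {x} {y} x≋y = mk≋ λ w →
  trans (coeff-ext f x w) (trans (pairing-cong _ x≋y) (sym (coeff-ext f y w)))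

ext-cong-fun : ∀ {f g} → (∀ u → f u ≋ g u) → ∀ x → ext f x ≋ ext g x
ext-cong-fun f≋g []            = ≋-refl
ext-cong-fun f≋g ((c , u) ∷ x) = ++-cong (·-cong c (f≋g u)) (ext-cong-fun f≋g x)

ext-++ : ∀ f x y → ext f (x ++ y) ≡ ext f x ++ ext f y
ext-++ f = concatMap-++ _

ext-· : ∀ f a x → ext f (a · x) ≋ a · ext f x
ext-· f a []            = ≋-refl
ext-· f a ((c , u) ∷ x) = ≋-trans
  (++-cong (≋-sym (·-assoc a c (f u))) (ext-· f a x))
  (≋-reflexive (sym (map-++ _ (c · f u) (ext f x))))

ext-⟦⟧ : ∀ f u → ext f ⟦ u ⟧ ≋ f u
ext-⟦⟧ f u = ≋-trans (≋-reflexive (++-identityʳ (1ℚ · f u))) (·-identityˡ (f u))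

ext-⟦⟧-id : ∀ x → ext ⟦_⟧ x ≋ x
ext-⟦⟧-id []            = ≋-refl
ext-⟦⟧-id ((c , u) ∷ x) =
  ++-cong {x = (c *ℚ 1ℚ , u) ∷ []} (≋-reflexive (cong (λ a → (a , u) ∷ []) (*-identityʳ c))) (ext-⟦⟧-id x)

record Linear (G : Lin → Lin) : Set where
  field
    ≋-cong  : ∀ {x y} → x ≋ y → G x ≋ G y
    ++-homo : ∀ x y → G (x ++ y) ≋ G x ++ G y
    ·-homo  : ∀ a x → G (a · x) ≋ a · G x

  []-homo : G [] ≋ []
  []-homo = ≋-trans (·-homo 0ℚ []) (·-zeroˡ (G []))
open Linear public

id-linear : Linear id
id-linear = record { ≋-cong = id ; ++-homo = λ _ _ → ≋-refl ; ·-homo = λ _ _ → ≋-refl }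

[]-linear : Linear (λ _ → [])
[]-linear = record { ≋-cong = λ _ → ≋-refl ; ++-homo = λ _ _ → ≋-refl ; ·-homo = λ _ _ → ≋-refl }

ext-linear : ∀ f → Linear (ext f)
ext-linear f = record
  { ≋-cong  = ext-cong f
  ; ++-homo = λ x y → ≋-reflexive (ext-++ f x y)
  ; ·-homo  = ext-· f
  }

∘-linear : ∀ {G H} → Linear G → Linear H → Linear (G ∘ H)
∘-linear LG LH = record
  { ≋-cong  = ≋-cong LG ∘ ≋-cong LH
  ; ++-homo = λ x y → ≋-trans (≋-cong LG (++-homo LH x y)) (++-homo LG _ _)
  ; ·-homo  = λ a x → ≋-trans (≋-cong LG (·-homo LH a x)) (·-homo LG a _)
  }

++-linear : ∀ {G H} → Linear G → Linear H → Linear (λ x → G x ++ H x)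
++-linear {G} {H} LG LH = record
  { ≋-cong  = λ x≋y → ++-cong (≋-cong LG x≋y) (≋-cong LH x≋y)
  ; ++-homo = λ x y → ≋-trans (++-cong (++-homo LG x y) (++-homo LH x y)) (++-interchange (G x) (G y) (H x) (H y))
  ; ·-homo  = λ a x → ≋-trans (++-cong (·-homo LG a x) (·-homo LH a x)) (≋-reflexive (sym (map-++ _ (G x) (H x))))
  }

scaling-linear : ∀ a → Linear (a ·_)
scaling-linear a = record
  { ≋-cong  = ·-cong a
  ; ++-homo = λ x y → ≋-reflexive (map-++ _ x y)
  ; ·-homo  = λ b x → ≋-trans (·-assoc a b x)
                        (≋-trans (≋-reflexive (cong (_· x) (*-comm a b))) (≋-sym (·-assoc b a x)))
  }

·-linear : ∀ a {G} → Linear G → Linear (λ x → a · G x)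
·-linear a = ∘-linear (scaling-linear a)

Linear-resp-≋ : ∀ {G H} → (∀ x → G x ≋ H x) → Linear H → Linear G
Linear-resp-≋ {G} {H} G≋H LH = record
  { ≋-cong  = λ {x} {y} x≋y → ≋-trans (G≋H x) (≋-trans (≋-cong LH x≋y) (≋-sym (G≋H y)))
  ; ++-homo = λ x y → ≋-trans (G≋H (x ++ y)) (≋-trans (++-homo LH x y) (≋-sym (++-cong (G≋H x) (G≋H y))))
  ; ·-homo  = λ a x → ≋-trans (G≋H (a · x)) (≋-trans (·-homo LH a x) (≋-sym (·-cong a (G≋H x))))
  }

ext-linear-in-family : ∀ {F : Index → Lin → Lin} → (∀ u → Linear (F u)) →
                       ∀ x → Linear (λ y → ext (λ u → F u y) x)
ext-linear-in-family LF []            = []-linear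
ext-linear-in-family LF ((c , u) ∷ x) = ++-linear (·-linear c (LF u)) (ext-linear-in-family LF x)

linear-ext : ∀ {G} → Linear G → ∀ f x → G (ext f x) ≋ ext (G ∘ f) x
linear-ext LG f []            = []-homo LG
linear-ext LG f ((c , u) ∷ x) =
  ≋-trans (++-homo LG (c · f u) (ext f x)) (++-cong (·-homo LG c (f u)) (linear-ext LG f x))

linear-≋-on-basis : ∀ {G H} → Linear G → Linear H → (∀ u → G ⟦ u ⟧ ≋ H ⟦ u ⟧) → ∀ x → G x ≋ H x
linear-≋-on-basis {G} {H} LG LH agree x = begin
  G x                    ≈⟨ ≋-cong LG (ext-⟦⟧-id x) ⟨
  G (ext ⟦_⟧ x)          ≈⟨ linear-ext LG ⟦_⟧ x ⟩
  ext (G ∘ ⟦_⟧) x        ≈⟨ ext-cong-fun agree x ⟩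
  ext (H ∘ ⟦_⟧) x        ≈⟨ linear-ext LH ⟦_⟧ x ⟨
  H (ext ⟦_⟧ x)          ≈⟨ ≋-cong LH (ext-⟦⟧-id x) ⟩
  H x                    ∎
  where open ≋-Reasoning

record Bilinear (B : Lin → Lin → Lin) : Set where
  field
    linearˡ : ∀ y → Linear (λ x → B x y)
    linearʳ : ∀ x → Linear (B x)
open Bilinear public

bilinear-≋-on-basis : ∀ {B B′} → Bilinear B → Bilinear B′ →
                      (∀ u v → B ⟦ u ⟧ ⟦ v ⟧ ≋ B′ ⟦ u ⟧ ⟦ v ⟧) → ∀ x y → B x y ≋ B′ x y
bilinear-≋-on-basis LB LB′ agree x y =
  linear-≋-on-basis (linearˡ LB y) (linearˡ LB′ y)
    (λ u → linear-≋-on-basis (linearʳ LB ⟦ u ⟧) (linearʳ LB′ ⟦ u ⟧) (agree u) y) x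

flip-bilinear : ∀ {B} → Bilinear B → Bilinear (flip B)
flip-bilinear LB = record { linearˡ = linearʳ LB ; linearʳ = linearˡ LB }

bilinear-∘₂ : ∀ {B G H} → Bilinear B → Linear G → Linear H → Bilinear (λ x y → B (G x) (H y))
bilinear-∘₂ LB LG LH = record
  { linearˡ = λ y → ∘-linear (linearˡ LB _) LG
  ; linearʳ = λ x → ∘-linear (linearʳ LB _) LH
  }

linear-∘-bilinear : ∀ {G B} → Linear G → Bilinear B → Bilinear (λ x y → G (B x y))
linear-∘-bilinear LG LB = record
  { linearˡ = λ y → ∘-linear LG (linearˡ LB y)
  ; linearʳ = λ x → ∘-linear LG (linearʳ LB x)
  }

++-bilinear : ∀ {B B′} → Bilinear B → Bilinear B′ → Bilinear (λ x y → B x y ++ B′ x y)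
++-bilinear LB LB′ = record
  { linearˡ = λ y → ++-linear (linearˡ LB y) (linearˡ LB′ y)
  ; linearʳ = λ x → ++-linear (linearʳ LB x) (linearʳ LB′ x)
  }

mapₑ : (Lin → Lin) → Expr → Expr
mapₑ G (atom x) = atom (G x)
mapₑ G (e ⊕ e′) = mapₑ G e ⊕ mapₑ G e′
mapₑ G (a ⊙ e)  = a ⊙ mapₑ G e

linear-⟦⟧ₑ : ∀ {G} → Linear G → ∀ e → G ⟦ e ⟧ₑ ≋ ⟦ mapₑ G e ⟧ₑ
linear-⟦⟧ₑ LG (atom x) = ≋-refl
linear-⟦⟧ₑ LG (e ⊕ e′) =
  ≋-trans (++-homo LG ⟦ e ⟧ₑ ⟦ e′ ⟧ₑ) (++-cong (linear-⟦⟧ₑ LG e) (linear-⟦⟧ₑ LG e′))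
linear-⟦⟧ₑ LG (a ⊙ e)  = ≋-trans (·-homo LG a ⟦ e ⟧ₑ) (·-cong a (linear-⟦⟧ₑ LG e))

pre : ℕ → Lin → Lin
pre m = ext (λ v → ⟦ m ∷ v ⟧)

post : ℕ → Lin → Lin
post m = ext (λ v → ⟦ v ∷ʳ m ⟧)

pre-linear : ∀ m → Linear (pre m)
pre-linear m = ext-linear (λ v → ⟦ m ∷ v ⟧)

post-linear : ∀ m → Linear (post m)
post-linear m = ext-linear (λ v → ⟦ v ∷ʳ m ⟧)

σ-linear : ∀ n → Linear (σ n)
σ-linear n = ext-linear (σIdx n)

pre-⟦⟧ : ∀ m u → pre m ⟦ u ⟧ ≋ ⟦ m ∷ u ⟧
pre-⟦⟧ m = ext-⟦⟧ (λ v → ⟦ m ∷ v ⟧)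

post-⟦⟧ : ∀ m u → post m ⟦ u ⟧ ≋ ⟦ u ∷ʳ m ⟧
post-⟦⟧ m = ext-⟦⟧ (λ v → ⟦ v ∷ʳ m ⟧)

σ-⟦⟧ : ∀ n u → σ n ⟦ u ⟧ ≋ σIdx n u
σ-⟦⟧ n = ext-⟦⟧ (σIdx n)

post-pre-⟦⟧ : ∀ k j u → post k (pre j ⟦ u ⟧) ≋ ⟦ j ∷ u ∷ʳ k ⟧
post-pre-⟦⟧ k j u = ≋-trans (≋-cong (post-linear k) (pre-⟦⟧ j u)) (post-⟦⟧ k (j ∷ u))

pre-post : ∀ j k x → pre j (post k x) ≋ post k (pre j x)
pre-post j k = linear-≋-on-basis (∘-linear (pre-linear j) (post-linear k)) (∘-linear (post-linear k) (pre-linear j))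
  λ u → begin
    pre j (post k ⟦ u ⟧)   ≈⟨ ≋-cong (pre-linear j) (post-⟦⟧ k u) ⟩
    pre j ⟦ u ∷ʳ k ⟧       ≈⟨ pre-⟦⟧ j (u ∷ʳ k) ⟩
    ⟦ j ∷ u ∷ʳ k ⟧         ≈⟨ post-⟦⟧ k (j ∷ u) ⟨
    post k ⟦ j ∷ u ⟧       ≈⟨ ≋-cong (post-linear k) (pre-⟦⟧ j u) ⟨
    post k (pre j ⟦ u ⟧)   ∎
  where open ≋-Reasoning

map-scaled-pre : ∀ a m x → map (λ { (c , w) → (a *ℚ c , m ∷ w) }) x ≋ a · pre m x
map-scaled-pre a m []            = ≋-refl
map-scaled-pre a m ((c , w) ∷ x) =
  ++-cong {x = (a *ℚ c , m ∷ w) ∷ []} (≋-reflexive (cong (λ b → (a *ℚ b , m ∷ w) ∷ []) (sym (*-identityʳ c))))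
          (map-scaled-pre a m x)

scaled-pre-cong : ∀ {a b m m′ x y} → a ≡ b → m ≡ m′ → x ≋ y → a · pre m x ≋ b · pre m′ y
scaled-pre-cong {a} {m = m} refl refl x≋y = ·-cong a (≋-cong (pre-linear m) x≋y)

unshifted-term : ∀ k x → map (λ { (c , w) → (fromℕℚ 1 *ℚ c , (k + 0) ∷ w) }) x ≋ pre k x
unshifted-term k x = ≋-trans (map-scaled-pre (fromℕℚ 1) (k + 0) x)
  (≋-trans (scaled-pre-cong {a = 1ℚ} refl (ℕ.+-identityʳ k) (≋-refl {x})) (·-identityˡ (pre k x)))

k+1∸1C1≡k : ∀ k → (k + 1 ∸ 1) C 1 ≡ k
k+1∸1C1≡k k = trans (cong (_C 1) (ℕ.m+n∸n≡m k 1)) (nC1≡n k)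

σIdx₀-id : ∀ w → σIdx 0 w ≋ ⟦ w ⟧
σIdx₀-id []      = ≋-refl
σIdx₀-id (k ∷ w) = begin
  σIdx 0 (k ∷ w)      ≈⟨ ≋-trans (≋-reflexive (++-identityʳ _)) (unshifted-term k (σIdx 0 w)) ⟩
  pre k (σIdx 0 w)    ≈⟨ ≋-cong (pre-linear k) (σIdx₀-id w) ⟩
  pre k ⟦ w ⟧         ≈⟨ pre-⟦⟧ k w ⟩
  ⟦ k ∷ w ⟧           ∎
  where open ≋-Reasoning

σIdx₁-∷ : ∀ k w → σIdx 1 (k ∷ w) ≋ pre k (σIdx 1 w) ++ fromℕℚ k · pre (suc k) ⟦ w ⟧
σIdx₁-∷ k w = begin
  σIdx 1 (k ∷ w)
    ≈⟨ ++-cong (unshifted-term k (σIdx 1 w))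
               (≋-trans (≋-reflexive (++-identityʳ _)) (map-scaled-pre c₁ (k + 1) (σIdx 0 w))) ⟩
  pre k (σIdx 1 w) ++ c₁ · pre (k + 1) (σIdx 0 w)
    ≈⟨ ++-cong (≋-refl {pre k (σIdx 1 w)})
               (scaled-pre-cong (cong fromℕℚ (k+1∸1C1≡k k)) (ℕ.+-comm k 1) (σIdx₀-id w)) ⟩
  pre k (σIdx 1 w) ++ fromℕℚ k · pre (suc k) ⟦ w ⟧
    ∎
  where
  open ≋-Reasoning
  c₁ = fromℕℚ ((k + 1 ∸ 1) C 1)

σIdx₂-∷ : ∀ k w → σIdx 2 (k ∷ w) ≋
  pre k (σIdx 2 w) ++ (fromℕℚ k · pre (suc k) (σIdx 1 w) ++ fromℕℚ (suc k C 2) · pre (suc (suc k)) ⟦ w ⟧)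
σIdx₂-∷ k w = begin
  σIdx 2 (k ∷ w)
    ≈⟨ ++-cong (unshifted-term k (σIdx 2 w))
               (++-cong (map-scaled-pre c₁ (k + 1) (σIdx 1 w))
                        (≋-trans (≋-reflexive (++-identityʳ _)) (map-scaled-pre c₂ (k + 2) (σIdx 0 w)))) ⟩
  pre k (σIdx 2 w) ++ (c₁ · pre (k + 1) (σIdx 1 w) ++ c₂ · pre (k + 2) (σIdx 0 w))
    ≈⟨ ++-cong (≋-refl {pre k (σIdx 2 w)})
               (++-cong (scaled-pre-cong (cong fromℕℚ (k+1∸1C1≡k k)) (ℕ.+-comm k 1) (≋-refl {σIdx 1 w}))
                        (scaled-pre-cong (cong (λ n → fromℕℚ ((n ∸ 1) C 2)) (ℕ.+-comm k 2)) (ℕ.+-comm k 2)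
                                         (σIdx₀-id w))) ⟩
  pre k (σIdx 2 w) ++ (fromℕℚ k · pre (suc k) (σIdx 1 w) ++ fromℕℚ (suc k C 2) · pre (suc (suc k)) ⟦ w ⟧)
    ∎
  where
  open ≋-Reasoning
  c₁ = fromℕℚ ((k + 1 ∸ 1) C 1)
  c₂ = fromℕℚ ((k + 2 ∸ 1) C 2)

σ₁-pre : ∀ k x → σ 1 (pre k x) ≋ pre k (σ 1 x) ++ fromℕℚ k · pre (suc k) x
σ₁-pre k = linear-≋-on-basis
  (∘-linear (σ-linear 1) (pre-linear k))
  (++-linear (∘-linear (pre-linear k) (σ-linear 1)) (·-linear (fromℕℚ k) (pre-linear (suc k))))
  λ u → begin
    σ 1 (pre k ⟦ u ⟧)                                   ≈⟨ ≋-cong (σ-linear 1) (pre-⟦⟧ k u) ⟩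
    σ 1 ⟦ k ∷ u ⟧                                       ≈⟨ σ-⟦⟧ 1 (k ∷ u) ⟩
    σIdx 1 (k ∷ u)                                      ≈⟨ σIdx₁-∷ k u ⟩
    pre k (σIdx 1 u) ++ fromℕℚ k · pre (suc k) ⟦ u ⟧    ≈⟨ ++-cong (≋-cong (pre-linear k) (σ-⟦⟧ 1 u)) ≋-refl ⟨
    pre k (σ 1 ⟦ u ⟧) ++ fromℕℚ k · pre (suc k) ⟦ u ⟧   ∎
  where open ≋-Reasoning

σIdx₁-∷ʳ : ∀ u k → σIdx 1 (u ∷ʳ k) ≋ post k (σIdx 1 u) ++ fromℕℚ k · post (suc k) ⟦ u ⟧
σIdx₁-∷ʳ []      k = ≋-trans (σIdx₁-∷ k [])
  (·-cong (fromℕℚ k) (≋-trans (pre-⟦⟧ (suc k) []) (≋-sym (post-⟦⟧ (suc k) []))))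
σIdx₁-∷ʳ (j ∷ u) k = begin
  σIdx 1 (j ∷ u ∷ʳ k)
    ≈⟨ σIdx₁-∷ j (u ∷ʳ k) ⟩
  pre j (σIdx 1 (u ∷ʳ k)) ++ J · pre (suc j) ⟦ u ∷ʳ k ⟧
    ≈⟨ ++-cong (≋-cong (pre-linear j) (σIdx₁-∷ʳ u k)) (·-cong J (pre-⟦⟧ (suc j) (u ∷ʳ k))) ⟩
  pre j (post k S ++ K · post (suc k) ⟦ u ⟧) ++ J · ⟦ suc j ∷ u ∷ʳ k ⟧
    ≈⟨ ++-cong pre-of-post (·-cong J (≋-sym (post-pre-⟦⟧ k (suc j) u))) ⟩
  (post k (pre j S) ++ K · post (suc k) ⟦ j ∷ u ⟧) ++ J · post k (pre (suc j) ⟦ u ⟧)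
    ≈⟨ ++-swapʳ (post k (pre j S)) (K · post (suc k) ⟦ j ∷ u ⟧) (J · post k (pre (suc j) ⟦ u ⟧)) ⟩
  (post k (pre j S) ++ J · post k (pre (suc j) ⟦ u ⟧)) ++ K · post (suc k) ⟦ j ∷ u ⟧
    ≈⟨ ++-cong (linear-⟦⟧ₑ (post-linear k) (atom (pre j S) ⊕ J ⊙ atom (pre (suc j) ⟦ u ⟧))) ≋-refl ⟨
  post k (pre j S ++ J · pre (suc j) ⟦ u ⟧) ++ K · post (suc k) ⟦ j ∷ u ⟧
    ≈⟨ ++-cong (≋-cong (post-linear k) (σIdx₁-∷ j u)) ≋-refl ⟨
  post k (σIdx 1 (j ∷ u)) ++ K · post (suc k) ⟦ j ∷ u ⟧
    ∎
  where
  open ≋-Reasoning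
  J = fromℕℚ j
  K = fromℕℚ k
  S = σIdx 1 u
  pre-of-post : pre j (post k S ++ K · post (suc k) ⟦ u ⟧) ≋ post k (pre j S) ++ K · post (suc k) ⟦ j ∷ u ⟧
  pre-of-post = ≋-trans (linear-⟦⟧ₑ (pre-linear j) (atom (post k S) ⊕ K ⊙ atom (post (suc k) ⟦ u ⟧)))
    (++-cong (pre-post j k S)
             (·-cong K (≋-trans (pre-post j (suc k) ⟦ u ⟧) (≋-cong (post-linear (suc k)) (pre-⟦⟧ j u)))))

σ₁-post : ∀ k x → σ 1 (post k x) ≋ post k (σ 1 x) ++ fromℕℚ k · post (suc k) x
σ₁-post k = linear-≋-on-basis
  (∘-linear (σ-linear 1) (post-linear k))
  (++-linear (∘-linear (post-linear k) (σ-linear 1)) (·-linear (fromℕℚ k) (post-linear (suc k))))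
  λ u → begin
    σ 1 (post k ⟦ u ⟧)                                    ≈⟨ ≋-cong (σ-linear 1) (post-⟦⟧ k u) ⟩
    σ 1 ⟦ u ∷ʳ k ⟧                                        ≈⟨ σ-⟦⟧ 1 (u ∷ʳ k) ⟩
    σIdx 1 (u ∷ʳ k)                                       ≈⟨ σIdx₁-∷ʳ u k ⟩
    post k (σIdx 1 u) ++ fromℕℚ k · post (suc k) ⟦ u ⟧    ≈⟨ ++-cong (≋-cong (post-linear k) (σ-⟦⟧ 1 u)) ≋-refl ⟨
    post k (σ 1 ⟦ u ⟧) ++ fromℕℚ k · post (suc k) ⟦ u ⟧   ∎
  where open ≋-Reasoning

2*[1+k]C2≡k*[1+k] : ∀ k → 2 * (suc k C 2) ≡ k * suc k
2*[1+k]C2≡k*[1+k] zero    = refl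
2*[1+k]C2≡k*[1+k] (suc k) = begin
  2 * (suc (suc k) C 2)            ≡⟨ cong (2 *_) (nCk+nC[k+1]≡[n+1]C[k+1] (suc k) 1) ⟨
  2 * (suc k C 1 + suc k C 2)      ≡⟨ cong (λ c → 2 * (c + suc k C 2)) (nC1≡n (suc k)) ⟩
  2 * (suc k + suc k C 2)          ≡⟨ ℕ.*-distribˡ-+ 2 (suc k) (suc k C 2) ⟩
  2 * suc k + 2 * (suc k C 2)      ≡⟨ cong (2 * suc k +_) (2*[1+k]C2≡k*[1+k] k) ⟩
  2 * suc k + k * suc k            ≡⟨ ℕ.*-distribʳ-+ (suc k) 2 k ⟨
  suc (suc k) * suc k              ≡⟨ ℕ.*-comm (suc (suc k)) (suc k) ⟩
  suc k * suc (suc k)              ∎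
  where open ≡-Reasoning

[1+k]k≡2[1+k]C2 : ∀ k → fromℕℚ (suc k) *ℚ fromℕℚ k ≡ fromℕℚ 2 *ℚ fromℕℚ (suc k C 2)
[1+k]k≡2[1+k]C2 k = begin
  fromℕℚ (suc k) *ℚ fromℕℚ k   ≡⟨ fromℕℚ-* (suc k) k ⟨
  fromℕℚ (suc k * k)           ≡⟨ cong fromℕℚ (ℕ.*-comm (suc k) k) ⟩
  fromℕℚ (k * suc k)           ≡⟨ cong fromℕℚ (2*[1+k]C2≡k*[1+k] k) ⟨
  fromℕℚ (2 * (suc k C 2))     ≡⟨ fromℕℚ-* 2 (suc k C 2) ⟩
  fromℕℚ 2 *ℚ fromℕℚ (suc k C 2) ∎
  where open ≡-Reasoning

σ₁-σIdx₁ : ∀ w → σ 1 (σIdx 1 w) ≋ fromℕℚ 2 · σIdx 2 w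
σ₁-σIdx₁ []      = ≋-refl
σ₁-σIdx₁ (k ∷ w) = begin
  σ 1 (σIdx 1 (k ∷ w))
    ≈⟨ ≋-cong (σ-linear 1) (σIdx₁-∷ k w) ⟩
  σ 1 (pre k (σIdx 1 w) ++ K · pre (suc k) ⟦ w ⟧)
    ≈⟨ linear-⟦⟧ₑ (σ-linear 1) (atom (pre k (σIdx 1 w)) ⊕ K ⊙ atom (pre (suc k) ⟦ w ⟧)) ⟩
  σ 1 (pre k (σIdx 1 w)) ++ K · σ 1 (pre (suc k) ⟦ w ⟧)
    ≈⟨ ++-cong (σ₁-pre k (σIdx 1 w)) (·-cong K (σ₁-pre (suc k) ⟦ w ⟧)) ⟩
  (pre k (σ 1 (σIdx 1 w)) ++ K · P₁) ++ K · (pre (suc k) (σ 1 ⟦ w ⟧) ++ K′ · P₂)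
    ≈⟨ ++-cong (++-cong induction ≋-refl) distribute ⟩
  (2ℚ · A ++ K · P₁) ++ (K · P₁ ++ (K′ *ℚ K) · P₂)
    ≡⟨ cong (λ c → (2ℚ · A ++ K · P₁) ++ (K · P₁ ++ c · P₂)) ([1+k]k≡2[1+k]C2 k) ⟩
  (2ℚ · A ++ K · P₁) ++ (K · P₁ ++ (2ℚ *ℚ c₂) · P₂)
    ≈⟨ ⟦⟧ₑ-≋ ((2ℚ ⊙ atom A ⊕ K ⊙ atom P₁) ⊕ (K ⊙ atom P₁ ⊕ (2ℚ *ℚ c₂) ⊙ atom P₂))
             (2ℚ ⊙ (atom A ⊕ (K ⊙ atom P₁ ⊕ c₂ ⊙ atom P₂)))
             (λ w → collect K c₂ (coeff A w) (coeff P₁ w) (coeff P₂ w)) ⟩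
  2ℚ · (A ++ (K · P₁ ++ c₂ · P₂))
    ≈⟨ ·-cong 2ℚ (σIdx₂-∷ k w) ⟨
  2ℚ · σIdx 2 (k ∷ w)
    ∎
  where
  open ≋-Reasoning
  2ℚ = fromℕℚ 2
  K  = fromℕℚ k
  K′ = fromℕℚ (suc k)
  c₂ = fromℕℚ (suc k C 2)
  A  = pre k (σIdx 2 w)
  P₁ = pre (suc k) (σIdx 1 w)
  P₂ = pre (suc (suc k)) ⟦ w ⟧
  induction : pre k (σ 1 (σIdx 1 w)) ≋ 2ℚ · A
  induction = ≋-trans (≋-cong (pre-linear k) (σ₁-σIdx₁ w)) (·-homo (pre-linear k) 2ℚ (σIdx 2 w))
  distribute : K · (pre (suc k) (σ 1 ⟦ w ⟧) ++ K′ · P₂) ≋ K · P₁ ++ (K′ *ℚ K) · P₂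
  distribute = ≋-trans (·-cong K (++-cong (≋-cong (pre-linear (suc k)) (σ-⟦⟧ 1 w)) ≋-refl))
    (≋-trans (linear-⟦⟧ₑ (scaling-linear K) (atom P₁ ⊕ K′ ⊙ atom P₂)) (++-cong ≋-refl (·-assoc K′ K P₂)))
  collect : ∀ κ γ a p₁ p₂ →
            (2ℚ *ℚ a +ℚ κ *ℚ p₁) +ℚ (κ *ℚ p₁ +ℚ (2ℚ *ℚ γ) *ℚ p₂) ≡ 2ℚ *ℚ (a +ℚ (κ *ℚ p₁ +ℚ γ *ℚ p₂))
  collect = solve 5 (λ κ γ a p₁ p₂ → (con 2ℚ :* a :+ κ :* p₁) :+ (κ :* p₁ :+ (con 2ℚ :* γ) :* p₂)
                                     := con 2ℚ :* (a :+ (κ :* p₁ :+ γ :* p₂))) refl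

-- The harmonic product

reverse-∷ʳ : ∀ {A : Set} (xs : List A) x → reverse (xs ∷ʳ x) ≡ x ∷ reverse xs
reverse-∷ʳ xs x = reverse-++ xs (x ∷ [])

post-map-reverse : ∀ k X → post k (map (λ w → (1ℚ , reverse w)) X) ≡ map (λ w → (1ℚ , reverse w)) (map (k ∷_) X)
post-map-reverse k []      = refl
post-map-reverse k (w ∷ X) = cong₂ (λ v → (1ℚ , v) ∷_) (sym (unfold-reverse k w)) (post-map-reverse k X)

harmIdx-∷ʳ : ∀ u k v l → harmIdx (u ∷ʳ k) (v ∷ʳ l) ≡
  post k (harmIdx u (v ∷ʳ l)) ++ (post l (harmIdx (u ∷ʳ k) v) ++ post (k + l) (harmIdx u v))
harmIdx-∷ʳ u k v l rewrite reverse-∷ʳ u k | reverse-∷ʳ v l =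
  trans (map-++ F (map (k ∷_) A) _)
        (cong₂ _++_ (sym (post-map-reverse k A))
                    (trans (map-++ F (map (l ∷_) B) _)
                           (cong₂ _++_ (sym (post-map-reverse l B)) (sym (post-map-reverse (k + l) C)))))
  where
  F = λ (w : Index) → (1ℚ , reverse w)
  A = harmRev (reverse u) (l ∷ reverse v)
  B = harmRev (k ∷ reverse u) (reverse v)
  C = harmRev (reverse u) (reverse v)

harmIdx-identityˡ : ∀ v → harmIdx [] v ≡ ⟦ v ⟧
harmIdx-identityˡ v = cong (λ w → (1ℚ , w) ∷ []) (reverse-involutive v)

harmIdx-identityʳ : ∀ u → harmIdx u [] ≡ ⟦ u ⟧
harmIdx-identityʳ u = trans (cong (map (λ w → (1ℚ , reverse w))) (harmRev-identityʳ (reverse u)))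
                            (harmIdx-identityˡ u)
  where
  harmRev-identityʳ : ∀ a → harmRev a [] ≡ a ∷ []
  harmRev-identityʳ []      = refl
  harmRev-identityʳ (_ ∷ _) = refl

harmIdx-comm : ∀ {u v} → Reverse u → Reverse v → harmIdx u v ≋ harmIdx v u
harmIdx-comm {v = v} [] _ = ≋-reflexive (trans (harmIdx-identityˡ v) (sym (harmIdx-identityʳ v)))
harmIdx-comm {u = u} (_ ∶ _ ∶ʳ _) [] = ≋-reflexive (trans (harmIdx-identityʳ u) (sym (harmIdx-identityˡ u)))
harmIdx-comm (u ∶ ru ∶ʳ k) (v ∶ rv ∶ʳ l) = begin
  harmIdx (u ∷ʳ k) (v ∷ʳ l)
    ≡⟨ harmIdx-∷ʳ u k v l ⟩
  post k (harmIdx u (v ∷ʳ l)) ++ (post l (harmIdx (u ∷ʳ k) v) ++ post (k + l) (harmIdx u v))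
    ≈⟨ ++-cong (≋-cong (post-linear k) (harmIdx-comm ru (v ∶ rv ∶ʳ l)))
               (++-cong (≋-cong (post-linear l) (harmIdx-comm (u ∶ ru ∶ʳ k) rv))
                        (≋-trans (≋-cong (post-linear (k + l)) (harmIdx-comm ru rv))
                                 (≋-reflexive (cong (λ m → post m (harmIdx v u)) (ℕ.+-comm k l))))) ⟩
  post k (harmIdx (v ∷ʳ l) u) ++ (post l (harmIdx v (u ∷ʳ k)) ++ post (l + k) (harmIdx v u))
    ≈⟨ ++-exchange (post k (harmIdx (v ∷ʳ l) u)) (post l (harmIdx v (u ∷ʳ k))) (post (l + k) (harmIdx v u)) ⟩
  post l (harmIdx v (u ∷ʳ k)) ++ (post k (harmIdx (v ∷ʳ l) u) ++ post (l + k) (harmIdx v u))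
    ≡⟨ harmIdx-∷ʳ v l u k ⟨
  harmIdx (v ∷ʳ l) (u ∷ʳ k)
    ∎
  where open ≋-Reasoning

✶-≋-ext : ∀ x y → x ✶ y ≋ ext (λ u → ext (harmIdx u) y) x
✶-≋-ext []            y = ≋-refl
✶-≋-ext ((a , u) ∷ x) y = ++-cong (row y) (✶-≋-ext x y)
  where
  row : ∀ y → concatMap (λ { (b , v) → (a *ℚ b) · harmIdx u v }) y ≋ a · ext (harmIdx u) y
  row []            = ≋-refl
  row ((b , v) ∷ y) = ≋-trans (++-cong (≋-sym (·-assoc a b (harmIdx u v))) (row y))
                              (≋-reflexive (sym (map-++ _ (b · harmIdx u v) (ext (harmIdx u) y))))

✶-bilinear : Bilinear _✶_
✶-bilinear = record
  { linearˡ = λ y → Linear-resp-≋ (λ x → ✶-≋-ext x y) (ext-linear (λ u → ext (harmIdx u) y))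
  ; linearʳ = λ x → Linear-resp-≋ (✶-≋-ext x) (ext-linear-in-family (ext-linear ∘ harmIdx) x)
  }

✶-cong : ∀ {x x′ y y′} → x ≋ x′ → y ≋ y′ → x ✶ y ≋ x′ ✶ y′
✶-cong {x′ = x′} {y} x≋x′ y≋y′ =
  ≋-trans (≋-cong (linearˡ ✶-bilinear y) x≋x′) (≋-cong (linearʳ ✶-bilinear x′) y≋y′)

✶-⟦⟧ : ∀ u v → ⟦ u ⟧ ✶ ⟦ v ⟧ ≋ harmIdx u v
✶-⟦⟧ u v = ≋-trans (✶-≋-ext ⟦ u ⟧ ⟦ v ⟧)
  (≋-trans (ext-⟦⟧ (λ u′ → ext (harmIdx u′) ⟦ v ⟧) u) (ext-⟦⟧ (harmIdx u) v))

✶-comm : ∀ x y → x ✶ y ≋ y ✶ x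
✶-comm = bilinear-≋-on-basis ✶-bilinear (flip-bilinear ✶-bilinear) λ u v →
  ≋-trans (✶-⟦⟧ u v) (≋-trans (harmIdx-comm (reverseView u) (reverseView v)) (≋-sym (✶-⟦⟧ v u)))

✶-identityˡ : ∀ x → ⟦ [] ⟧ ✶ x ≋ x
✶-identityˡ = linear-≋-on-basis (linearʳ ✶-bilinear ⟦ [] ⟧) id-linear λ v →
  ≋-trans (✶-⟦⟧ [] v) (≋-reflexive (harmIdx-identityˡ v))

✶-identityʳ : ∀ x → x ✶ ⟦ [] ⟧ ≋ x
✶-identityʳ = linear-≋-on-basis (linearˡ ✶-bilinear ⟦ [] ⟧) id-linear λ u →
  ≋-trans (✶-⟦⟧ u []) (≋-reflexive (harmIdx-identityʳ u))

✶-post : ∀ m m′ x y → post m x ✶ post m′ y ≋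
  post m (x ✶ post m′ y) ++ (post m′ (post m x ✶ y) ++ post (m + m′) (x ✶ y))
✶-post m m′ = bilinear-≋-on-basis
  (bilinear-∘₂ ✶-bilinear (post-linear m) (post-linear m′))
  (++-bilinear (linear-∘-bilinear (post-linear m) (bilinear-∘₂ ✶-bilinear id-linear (post-linear m′)))
    (++-bilinear (linear-∘-bilinear (post-linear m′) (bilinear-∘₂ ✶-bilinear (post-linear m) id-linear))
                 (linear-∘-bilinear (post-linear (m + m′)) ✶-bilinear)))
  λ u v → begin
    post m ⟦ u ⟧ ✶ post m′ ⟦ v ⟧
      ≈⟨ ✶-post-⟦⟧ (post-⟦⟧ m u) (post-⟦⟧ m′ v) ⟩
    harmIdx (u ∷ʳ m) (v ∷ʳ m′)
      ≡⟨ harmIdx-∷ʳ u m v m′ ⟩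
    post m (harmIdx u (v ∷ʳ m′)) ++ (post m′ (harmIdx (u ∷ʳ m) v) ++ post (m + m′) (harmIdx u v))
      ≈⟨ ++-cong (≋-cong (post-linear m) (✶-post-⟦⟧ (≋-refl {⟦ u ⟧}) (post-⟦⟧ m′ v)))
                 (++-cong (≋-cong (post-linear m′) (✶-post-⟦⟧ (post-⟦⟧ m u) (≋-refl {⟦ v ⟧})))
                          (≋-cong (post-linear (m + m′)) (✶-⟦⟧ u v))) ⟨
    post m (⟦ u ⟧ ✶ post m′ ⟦ v ⟧) ++ (post m′ (post m ⟦ u ⟧ ✶ ⟦ v ⟧) ++ post (m + m′) (⟦ u ⟧ ✶ ⟦ v ⟧))
      ∎
  where
  open ≋-Reasoning
  ✶-post-⟦⟧ : ∀ {x y u v} → x ≋ ⟦ u ⟧ → y ≋ ⟦ v ⟧ → x ✶ y ≋ harmIdx u v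
  ✶-post-⟦⟧ {u = u} {v} x≋u y≋v = ≋-trans (✶-cong x≋u y≋v) (✶-⟦⟧ u v)

-- σ₁ is a derivation

Leibniz : Lin → Lin → Set
Leibniz x y = σ 1 (x ✶ y) ≋ σ 1 x ✶ y ++ x ✶ σ 1 y

leibniz-resp-≋ : ∀ {x x′ y y′} → x ≋ x′ → y ≋ y′ → Leibniz x y → Leibniz x′ y′
leibniz-resp-≋ x≋x′ y≋y′ leibniz = ≋-trans (≋-cong (σ-linear 1) (✶-cong (≋-sym x≋x′) (≋-sym y≋y′)))
  (≋-trans leibniz
    (++-cong (✶-cong (≋-cong (σ-linear 1) x≋x′) y≋y′) (✶-cong x≋x′ (≋-cong (σ-linear 1) y≋y′))))

-- σ 1 ⟦ [] ⟧ reduces to [], so the first summand on the right is [] ✶ y = [].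
leibniz-identityˡ : ∀ y → Leibniz ⟦ [] ⟧ y
leibniz-identityˡ y = ≋-trans (≋-cong (σ-linear 1) (✶-identityˡ y)) (≋-sym (✶-identityˡ (σ 1 y)))

leibniz-identityʳ : ∀ x → Leibniz x ⟦ [] ⟧
leibniz-identityʳ x = ≋-trans (≋-cong (σ-linear 1) (✶-identityʳ x))
  (≋-sym (≋-trans (++-cong (✶-identityʳ (σ 1 x)) ([]-homo (linearʳ ✶-bilinear x)))
                  (≋-reflexive (++-identityʳ (σ 1 x)))))

leibniz-post : ∀ k l {x y} → Leibniz x (post l y) → Leibniz (post k x) y → Leibniz x y →
               Leibniz (post k x) (post l y)
leibniz-post k l {x} {y} h₁ h₂ h₃ = begin
  σ 1 (post k x ✶ post l y)                                 ≈⟨ expand-left ⟩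
  ⟦ eL ⟧ₑ                                                   ≈⟨ ⟦⟧ₑ-≋ eL eR regroup ⟩
  ⟦ eR ⟧ₑ                                                   ≈⟨ expand-right ⟨
  σ 1 (post k x) ✶ post l y ++ post k x ✶ σ 1 (post l y)   ∎
  where
  open ≋-Reasoning
  K = fromℕℚ k
  L = fromℕℚ l
  a₁  = post k (σ 1 x ✶ post l y)
  a₂  = post k (x ✶ post l (σ 1 y))
  a₃  = post k (x ✶ post (suc l) y)
  a₄  = post (suc k) (x ✶ post l y)
  a₅  = post l (post k (σ 1 x) ✶ y)
  a₆  = post l (post (suc k) x ✶ y)
  a₇  = post l (post k x ✶ σ 1 y)
  a₈  = post (suc l) (post k x ✶ y)
  a₉  = post (k + l) (σ 1 x ✶ y)
  a₁₀ = post (k + l) (x ✶ σ 1 y)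
  a₁₁ = post (suc (k + l)) (x ✶ y)

  eL eR : Expr
  eL = ((atom a₁ ⊕ (atom a₂ ⊕ L ⊙ atom a₃)) ⊕ K ⊙ atom a₄)
     ⊕ ((((atom a₅ ⊕ K ⊙ atom a₆) ⊕ atom a₇) ⊕ L ⊙ atom a₈)
       ⊕ ((atom a₉ ⊕ atom a₁₀) ⊕ (K +ℚ L) ⊙ atom a₁₁))
  eR = ((atom a₁ ⊕ (atom a₅ ⊕ atom a₉)) ⊕ K ⊙ (atom a₄ ⊕ (atom a₆ ⊕ atom a₁₁)))
     ⊕ ((atom a₂ ⊕ (atom a₇ ⊕ atom a₁₀)) ⊕ L ⊙ (atom a₃ ⊕ (atom a₈ ⊕ atom a₁₁)))

  regroup : ∀ w → coeffₑ eL w ≡ coeffₑ eR w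
  regroup w = solve 13 (λ K L a₁ a₂ a₃ a₄ a₅ a₆ a₇ a₈ a₉ a₁₀ a₁₁ →
      ((a₁ :+ (a₂ :+ L :* a₃)) :+ K :* a₄)
        :+ ((((a₅ :+ K :* a₆) :+ a₇) :+ L :* a₈) :+ ((a₉ :+ a₁₀) :+ (K :+ L) :* a₁₁))
    := ((a₁ :+ (a₅ :+ a₉)) :+ K :* (a₄ :+ (a₆ :+ a₁₁)))
        :+ ((a₂ :+ (a₇ :+ a₁₀)) :+ L :* (a₃ :+ (a₈ :+ a₁₁)))) refl
    K L (c a₁) (c a₂) (c a₃) (c a₄) (c a₅) (c a₆) (c a₇) (c a₈) (c a₉) (c a₁₀) (c a₁₁)
    where c = λ z → coeff z w

  σ₁-post-✶ˡ : ∀ z → σ 1 (post k x) ✶ z ≋ post k (σ 1 x) ✶ z ++ K · (post (suc k) x ✶ z)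
  σ₁-post-✶ˡ z = ≋-trans (≋-cong (linearˡ ✶-bilinear z) (σ₁-post k x))
    (linear-⟦⟧ₑ (linearˡ ✶-bilinear z) (atom (post k (σ 1 x)) ⊕ K ⊙ atom (post (suc k) x)))

  σ₁-post-✶ʳ : ∀ z → z ✶ σ 1 (post l y) ≋ z ✶ post l (σ 1 y) ++ L · (z ✶ post (suc l) y)
  σ₁-post-✶ʳ z = ≋-trans (≋-cong (linearʳ ✶-bilinear z) (σ₁-post l y))
    (linear-⟦⟧ₑ (linearʳ ✶-bilinear z) (atom (post l (σ 1 y)) ⊕ L ⊙ atom (post (suc l) y)))

  expand-left : σ 1 (post k x ✶ post l y) ≋ ⟦ eL ⟧ₑ
  expand-left = begin
    σ 1 (post k x ✶ post l y)
      ≈⟨ ≋-cong (σ-linear 1) (✶-post k l x y) ⟩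
    σ 1 (post k H₁ ++ (post l H₂ ++ post (k + l) H₃))
      ≈⟨ linear-⟦⟧ₑ (σ-linear 1) (atom (post k H₁) ⊕ (atom (post l H₂) ⊕ atom (post (k + l) H₃))) ⟩
    σ 1 (post k H₁) ++ (σ 1 (post l H₂) ++ σ 1 (post (k + l) H₃))
      ≈⟨ ++-cong (σ₁-post k H₁) (++-cong (σ₁-post l H₂) (σ₁-post (k + l) H₃)) ⟩
    (post k (σ 1 H₁) ++ K · a₄)
      ++ ((post l (σ 1 H₂) ++ L · a₈) ++ (post (k + l) (σ 1 H₃) ++ fromℕℚ (k + l) · a₁₁))
      ≈⟨ ++-cong (++-cong term₁ ≋-refl)
                 (++-cong (++-cong term₂ ≋-refl)
                          (++-cong term₃ (≋-reflexive (cong (_· a₁₁) (fromℕℚ-+ k l))))) ⟩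
    ⟦ eL ⟧ₑ ∎
    where
    H₁ = x ✶ post l y
    H₂ = post k x ✶ y
    H₃ = x ✶ y
    term₁ : post k (σ 1 H₁) ≋ a₁ ++ (a₂ ++ L · a₃)
    term₁ = ≋-trans (≋-cong (post-linear k) (≋-trans h₁ (++-cong ≋-refl (σ₁-post-✶ʳ x))))
      (linear-⟦⟧ₑ (post-linear k)
        (atom (σ 1 x ✶ post l y) ⊕ (atom (x ✶ post l (σ 1 y)) ⊕ L ⊙ atom (x ✶ post (suc l) y))))
    term₂ : post l (σ 1 H₂) ≋ (a₅ ++ K · a₆) ++ a₇
    term₂ = ≋-trans (≋-cong (post-linear l) (≋-trans h₂ (++-cong (σ₁-post-✶ˡ y) ≋-refl)))
      (linear-⟦⟧ₑ (post-linear l)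
        ((atom (post k (σ 1 x) ✶ y) ⊕ K ⊙ atom (post (suc k) x ✶ y)) ⊕ atom (post k x ✶ σ 1 y)))
    term₃ : post (k + l) (σ 1 H₃) ≋ a₉ ++ a₁₀
    term₃ = ≋-trans (≋-cong (post-linear (k + l)) h₃)
      (linear-⟦⟧ₑ (post-linear (k + l)) (atom (σ 1 x ✶ y) ⊕ atom (x ✶ σ 1 y)))

  expand-right : σ 1 (post k x) ✶ post l y ++ post k x ✶ σ 1 (post l y) ≋ ⟦ eR ⟧ₑ
  expand-right = begin
    σ 1 (post k x) ✶ post l y ++ post k x ✶ σ 1 (post l y)
      ≈⟨ ++-cong (σ₁-post-✶ˡ (post l y)) (σ₁-post-✶ʳ (post k x)) ⟩
    (post k (σ 1 x) ✶ post l y ++ K · (post (suc k) x ✶ post l y))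
      ++ (post k x ✶ post l (σ 1 y) ++ L · (post k x ✶ post (suc l) y))
      ≈⟨ ++-cong (++-cong (✶-post k l (σ 1 x) y) (·-cong K (✶-post (suc k) l x y)))
                 (++-cong (✶-post k l x (σ 1 y))
                          (·-cong L (≋-trans (✶-post k (suc l) x y)
                                             (≋-reflexive (cong (λ m → a₃ ++ (a₈ ++ post m (x ✶ y)))
                                                                (ℕ.+-suc k l)))))) ⟩
    ⟦ eR ⟧ₑ ∎

leibniz-words : ∀ {u v} → Reverse u → Reverse v → Leibniz ⟦ u ⟧ ⟦ v ⟧
leibniz-words {v = v} []     _  = leibniz-identityˡ ⟦ v ⟧
leibniz-words {u = u} (_ ∶ _ ∶ʳ _) [] = leibniz-identityʳ ⟦ u ⟧
leibniz-words (u ∶ ru ∶ʳ k) (v ∶ rv ∶ʳ l) =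
  leibniz-resp-≋ (post-⟦⟧ k u) (post-⟦⟧ l v) (leibniz-post k l {⟦ u ⟧} {⟦ v ⟧}
    (leibniz-resp-≋ (≋-refl {⟦ u ⟧}) (≋-sym (post-⟦⟧ l v)) (leibniz-words ru (v ∶ rv ∶ʳ l)))
    (leibniz-resp-≋ (≋-sym (post-⟦⟧ k u)) (≋-refl {⟦ v ⟧}) (leibniz-words (u ∶ ru ∶ʳ k) rv))
    (leibniz-words ru rv))

σ₁-leibniz : ∀ x y → Leibniz x y
σ₁-leibniz = bilinear-≋-on-basis
  (linear-∘-bilinear (σ-linear 1) ✶-bilinear)
  (++-bilinear (bilinear-∘₂ ✶-bilinear (σ-linear 1) id-linear) (bilinear-∘₂ ✶-bilinear id-linear (σ-linear 1)))
  (λ u v → leibniz-words (reverseView u) (reverseView v))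

σ₁∘σ₁ : ∀ x → σ 1 (σ 1 x) ≋ fromℕℚ 2 · σ 2 x
σ₁∘σ₁ = linear-≋-on-basis (∘-linear (σ-linear 1) (σ-linear 1)) (·-linear (fromℕℚ 2) (σ-linear 2)) λ u →
  ≋-trans (≋-cong (σ-linear 1) (σ-⟦⟧ 1 u))
          (≋-trans (σ₁-σIdx₁ u) (·-cong (fromℕℚ 2) (≋-sym (σ-⟦⟧ 2 u))))

·-cancelˡ : ∀ {a} b → b *ℚ a ≡ 1ℚ → ∀ {x y} → a · x ≋ a · y → x ≋ y
·-cancelˡ {a} b ba≡1 {x} {y} ax≋ay = begin
  x                ≈⟨ ·-identityˡ x ⟨
  1ℚ · x           ≡⟨ cong (_· x) ba≡1 ⟨
  (b *ℚ a) · x     ≈⟨ ·-assoc b a x ⟨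
  b · (a · x)      ≈⟨ ·-cong b ax≋ay ⟩
  b · (a · y)      ≈⟨ ·-assoc b a y ⟩
  (b *ℚ a) · y     ≡⟨ cong (_· y) ba≡1 ⟩
  1ℚ · y           ≈⟨ ·-identityˡ y ⟩
  y                ∎
  where open ≋-Reasoning

σ₂-leibniz : ∀ x y → σ 2 (x ✶ y) ≋ (x ✶ σ 2 y ++ σ 1 x ✶ σ 1 y) ++ σ 2 x ✶ y
σ₂-leibniz x y = ·-cancelˡ ½ refl (begin
  2ℚ · σ 2 (x ✶ y)                                ≈⟨ σ₁∘σ₁ (x ✶ y) ⟨
  σ 1 (σ 1 (x ✶ y))                               ≈⟨ ≋-cong (σ-linear 1) (σ₁-leibniz x y) ⟩
  σ 1 (σ 1 x ✶ y ++ x ✶ σ 1 y)                    ≈⟨ ++-homo (σ-linear 1) (σ 1 x ✶ y) (x ✶ σ 1 y) ⟩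
  σ 1 (σ 1 x ✶ y) ++ σ 1 (x ✶ σ 1 y)              ≈⟨ ++-cong (σ₁-leibniz (σ 1 x) y) (σ₁-leibniz x (σ 1 y)) ⟩
  (σ 1 (σ 1 x) ✶ y ++ Q) ++ (Q ++ x ✶ σ 1 (σ 1 y))  ≈⟨ ++-cong (++-cong outerˡ ≋-refl) (++-cong ≋-refl outerʳ) ⟩
  (2ℚ · R ++ Q) ++ (Q ++ 2ℚ · P)                  ≈⟨ ⟦⟧ₑ-≋ ((2ℚ ⊙ atom R ⊕ atom Q) ⊕ (atom Q ⊕ 2ℚ ⊙ atom P))
                                                           (2ℚ ⊙ ((atom P ⊕ atom Q) ⊕ atom R)) collect ⟩
  2ℚ · ((P ++ Q) ++ R)                            ∎)
  where
  open ≋-Reasoning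
  2ℚ = fromℕℚ 2
  P = x ✶ σ 2 y
  Q = σ 1 x ✶ σ 1 y
  R = σ 2 x ✶ y
  outerˡ : σ 1 (σ 1 x) ✶ y ≋ 2ℚ · R
  outerˡ = ≋-trans (≋-cong (linearˡ ✶-bilinear y) (σ₁∘σ₁ x)) (·-homo (linearˡ ✶-bilinear y) 2ℚ (σ 2 x))
  outerʳ : x ✶ σ 1 (σ 1 y) ≋ 2ℚ · P
  outerʳ = ≋-trans (≋-cong (linearʳ ✶-bilinear x) (σ₁∘σ₁ y)) (·-homo (linearʳ ✶-bilinear x) 2ℚ (σ 2 y))
  collect : ∀ w → (2ℚ *ℚ coeff R w +ℚ coeff Q w) +ℚ (coeff Q w +ℚ 2ℚ *ℚ coeff P w)
                  ≡ 2ℚ *ℚ ((coeff P w +ℚ coeff Q w) +ℚ coeff R w)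
  collect w = solve 3 (λ a b c → (con 2ℚ :* c :+ b) :+ (b :+ con 2ℚ :* a) := con 2ℚ :* ((a :+ b) :+ c)) refl
                (coeff P w) (coeff Q w) (coeff R w)

-- The maps ₘIₙ

sumUpTo : ℕ → (ℕ → Lin) → Lin
sumUpTo zero    g = []
sumUpTo (suc n) g = g 0 ++ sumUpTo n (g ∘ suc)

concatMap-applyUpTo : ∀ n f (g : ℕ → Lin) → concatMap g (applyUpTo f n) ≡ sumUpTo n (g ∘ f)
concatMap-applyUpTo zero    f g = refl
concatMap-applyUpTo (suc n) f g = cong (g (f 0) ++_) (concatMap-applyUpTo n (f ∘ suc) g)

sumUpTo-cong : ∀ n {g h} → (∀ i → g i ≋ h i) → sumUpTo n g ≋ sumUpTo n h
sumUpTo-cong zero    g≋h = ≋-refl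
sumUpTo-cong (suc n) g≋h = ++-cong (g≋h 0) (sumUpTo-cong n (g≋h ∘ suc))

linear-sumUpTo : ∀ {G} → Linear G → ∀ n g → G (sumUpTo n g) ≋ sumUpTo n (G ∘ g)
linear-sumUpTo LG zero    g = []-homo LG
linear-sumUpTo LG (suc n) g = ≋-trans (++-homo LG (g 0) _) (++-cong ≋-refl (linear-sumUpTo LG n (g ∘ suc)))

sumUpTo-++ : ∀ n g h → sumUpTo n g ++ sumUpTo n h ≋ sumUpTo n (λ i → g i ++ h i)
sumUpTo-++ zero    g h = ≋-refl
sumUpTo-++ (suc n) g h = ≋-trans (++-interchange (g 0) (sumUpTo n (g ∘ suc)) (h 0) (sumUpTo n (h ∘ suc)))
                                 (++-cong ≋-refl (sumUpTo-++ n (g ∘ suc) (h ∘ suc)))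

sumUpTo-∷ʳ : ∀ n g → sumUpTo (suc n) g ≋ sumUpTo n g ++ g n
sumUpTo-∷ʳ zero    g = ++-comm (g 0) []
sumUpTo-∷ʳ (suc n) g = ≋-trans (++-cong (≋-refl {g 0}) (sumUpTo-∷ʳ n (g ∘ suc)))
                               (≋-reflexive (sym (++-assoc (g 0) (sumUpTo n (g ∘ suc)) (g (suc n)))))

sumUpTo-reverse : ∀ n g → sumUpTo (suc n) g ≋ sumUpTo (suc n) (λ i → g (n ∸ i))
sumUpTo-reverse zero    g = ≋-refl
sumUpTo-reverse (suc n) g = begin
  sumUpTo (suc (suc n)) g                          ≈⟨ sumUpTo-∷ʳ (suc n) g ⟩
  sumUpTo (suc n) g ++ g (suc n)                   ≈⟨ ++-cong (sumUpTo-reverse n g) ≋-refl ⟩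
  sumUpTo (suc n) (λ i → g (n ∸ i)) ++ g (suc n)   ≈⟨ ++-comm _ (g (suc n)) ⟩
  sumUpTo (suc (suc n)) (λ i → g (suc n ∸ i))      ∎
  where open ≋-Reasoning

take-length-++ : ∀ {A : Set} (xs ys : List A) → take (length xs) (xs ++ ys) ≡ xs
take-length-++ []       ys = refl
take-length-++ (x ∷ xs) ys = cong (x ∷_) (take-length-++ xs ys)

drop-length-++ : ∀ {A : Set} (xs ys : List A) → drop (length xs) (xs ++ ys) ≡ ys
drop-length-++ []       ys = refl
drop-length-++ (x ∷ xs) ys = drop-length-++ xs ys

reverse-take++drop : ∀ {A : Set} i (xs : List A) → reverse xs ≡ reverse (drop i xs) ++ reverse (take i xs)
reverse-take++drop i xs = trans (cong reverse (sym (take++drop≡id i xs))) (reverse-++ (take i xs) (drop i xs))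

length-reverse-drop : ∀ {A : Set} i (xs : List A) → length (reverse (drop i xs)) ≡ length xs ∸ i
length-reverse-drop i xs = trans (length-reverse (drop i xs)) (length-drop i xs)

take-reverse : ∀ {A : Set} i (xs : List A) → take (length xs ∸ i) (reverse xs) ≡ reverse (drop i xs)
take-reverse i xs rewrite sym (length-reverse-drop i xs) | reverse-take++drop i xs =
  take-length-++ (reverse (drop i xs)) (reverse (take i xs))

drop-reverse : ∀ {A : Set} i (xs : List A) → drop (length xs ∸ i) (reverse xs) ≡ reverse (take i xs)
drop-reverse i xs rewrite sym (length-reverse-drop i xs) | reverse-take++drop i xs =
  drop-length-++ (reverse (drop i xs)) (reverse (take i xs))

sum-take-drop : ∀ i (ks : List ℕ) → sum (take i ks) + sum (drop i ks) ≡ sum ks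
sum-take-drop i ks = trans (sym (sum-++ (take i ks) (drop i ks))) (cong sum (take++drop≡id i ks))

mIn-term : ℕ → ℕ → Index → ℕ → Lin
mIn-term m n ks i = sgn (sum (drop i ks)) · (σIdx m (take i ks) ✶ σIdx n (reverse (drop i ks)))

mIn-sumUpTo : ∀ m n ks → mIn m n ks ≡ sumUpTo (suc (length ks)) (mIn-term m n ks)
mIn-sumUpTo m n ks = concatMap-applyUpTo (suc (length ks)) id (mIn-term m n ks)

-- Also for i > length ks, where both sides are the term with all of ks under σₙ.
mIn-term-reverse : ∀ m n ks → 2 ∣ sum ks → ∀ i →
                   mIn-term m n (reverse ks) (length ks ∸ i) ≋ mIn-term n m ks i
mIn-term-reverse m n ks 2∣Σks i = begin
  mIn-term m n (reverse ks) (length ks ∸ i)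
    ≡⟨ cong₂ (λ d t → sgn (sum d) · (σIdx m t ✶ σIdx n (reverse d))) (drop-reverse i ks) (take-reverse i ks) ⟩
  sgn (sum (reverse (take i ks))) · (σIdx m (reverse (drop i ks)) ✶ σIdx n (reverse (reverse (take i ks))))
    ≡⟨ cong₂ (λ s v → s · (σIdx m (reverse (drop i ks)) ✶ σIdx n v))
             sign-agrees (reverse-involutive (take i ks)) ⟩
  sgn (sum (drop i ks)) · (σIdx m (reverse (drop i ks)) ✶ σIdx n (take i ks))
    ≈⟨ ·-cong (sgn (sum (drop i ks))) (✶-comm (σIdx m (reverse (drop i ks))) (σIdx n (take i ks))) ⟩
  mIn-term n m ks i
    ∎
  where
  open ≋-Reasoning
  sign-agrees : sgn (sum (reverse (take i ks))) ≡ sgn (sum (drop i ks))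
  sign-agrees = trans (cong sgn (sum-↭ (↭-reverse (take i ks))))
    (2∣m+n⇒sgn[m]≡sgn[n] (sum (take i ks)) (sum (drop i ks)) (subst (2 ∣_) (sym (sum-take-drop i ks)) 2∣Σks))

mIn-reverse : ∀ m n ks → 2 ∣ sum ks → mIn m n (reverse ks) ≋ mIn n m ks
mIn-reverse m n ks 2∣Σks = begin
  mIn m n (reverse ks)
    ≡⟨ trans (mIn-sumUpTo m n (reverse ks))
             (cong (λ r → sumUpTo (suc r) (mIn-term m n (reverse ks))) (length-reverse ks)) ⟩
  sumUpTo (suc (length ks)) (mIn-term m n (reverse ks))
    ≈⟨ sumUpTo-reverse (length ks) (mIn-term m n (reverse ks)) ⟩
  sumUpTo (suc (length ks)) (λ i → mIn-term m n (reverse ks) (length ks ∸ i))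
    ≈⟨ sumUpTo-cong (suc (length ks)) (mIn-term-reverse m n ks 2∣Σks) ⟩
  sumUpTo (suc (length ks)) (mIn-term n m ks)
    ≡⟨ mIn-sumUpTo n m ks ⟨
  mIn n m ks
    ∎
  where open ≋-Reasoning

σ₂-leibniz-σIdx : ∀ u v →
  (σIdx 0 u ✶ σIdx 2 v ++ σIdx 1 u ✶ σIdx 1 v) ++ σIdx 2 u ✶ σIdx 0 v ≋ σ 2 (σIdx 0 u ✶ σIdx 0 v)
σ₂-leibniz-σIdx u v = begin
  (σIdx 0 u ✶ σIdx 2 v ++ σIdx 1 u ✶ σIdx 1 v) ++ σIdx 2 u ✶ σIdx 0 v
    ≈⟨ ++-cong (++-cong (✶-cong (σIdx₀-id u) (≋-sym (σ-⟦⟧ 2 v)))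
                        (✶-cong (≋-sym (σ-⟦⟧ 1 u)) (≋-sym (σ-⟦⟧ 1 v))))
               (✶-cong (≋-sym (σ-⟦⟧ 2 u)) (σIdx₀-id v)) ⟩
  (⟦ u ⟧ ✶ σ 2 ⟦ v ⟧ ++ σ 1 ⟦ u ⟧ ✶ σ 1 ⟦ v ⟧) ++ σ 2 ⟦ u ⟧ ✶ ⟦ v ⟧
    ≈⟨ σ₂-leibniz ⟦ u ⟧ ⟦ v ⟧ ⟨
  σ 2 (⟦ u ⟧ ✶ ⟦ v ⟧)
    ≈⟨ ≋-cong (σ-linear 2) (✶-cong (σIdx₀-id u) (σIdx₀-id v)) ⟨
  σ 2 (σIdx 0 u ✶ σIdx 0 v)
    ∎
  where open ≋-Reasoning

mIn-σ₂ : ∀ ks → (mIn 0 2 ks ++ mIn 1 1 ks) ++ mIn 2 0 ks ≋ σ 2 (mIn 0 0 ks)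
mIn-σ₂ ks = begin
  (mIn 0 2 ks ++ mIn 1 1 ks) ++ mIn 2 0 ks
    ≡⟨ cong₂ _++_ (cong₂ _++_ (mIn-sumUpTo 0 2 ks) (mIn-sumUpTo 1 1 ks)) (mIn-sumUpTo 2 0 ks) ⟩
  (sumUpTo N (mIn-term 0 2 ks) ++ sumUpTo N (mIn-term 1 1 ks)) ++ sumUpTo N (mIn-term 2 0 ks)
    ≈⟨ ≋-trans (++-cong (sumUpTo-++ N (mIn-term 0 2 ks) (mIn-term 1 1 ks)) ≋-refl)
               (sumUpTo-++ N (λ i → mIn-term 0 2 ks i ++ mIn-term 1 1 ks i) (mIn-term 2 0 ks)) ⟩
  sumUpTo N (λ i → (mIn-term 0 2 ks i ++ mIn-term 1 1 ks i) ++ mIn-term 2 0 ks i)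
    ≈⟨ sumUpTo-cong N term-σ₂ ⟩
  sumUpTo N (σ 2 ∘ mIn-term 0 0 ks)
    ≈⟨ linear-sumUpTo (σ-linear 2) N (mIn-term 0 0 ks) ⟨
  σ 2 (sumUpTo N (mIn-term 0 0 ks))
    ≡⟨ cong (σ 2) (mIn-sumUpTo 0 0 ks) ⟨
  σ 2 (mIn 0 0 ks)
    ∎
  where
  open ≋-Reasoning
  N = suc (length ks)
  term-σ₂ : ∀ i → (mIn-term 0 2 ks i ++ mIn-term 1 1 ks i) ++ mIn-term 2 0 ks i ≋ σ 2 (mIn-term 0 0 ks i)
  term-σ₂ i = begin
    (s · (σIdx 0 A ✶ σIdx 2 B) ++ s · (σIdx 1 A ✶ σIdx 1 B)) ++ s · (σIdx 2 A ✶ σIdx 0 B)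
      ≈⟨ linear-⟦⟧ₑ (scaling-linear s)
           ((atom (σIdx 0 A ✶ σIdx 2 B) ⊕ atom (σIdx 1 A ✶ σIdx 1 B)) ⊕ atom (σIdx 2 A ✶ σIdx 0 B)) ⟨
    s · ((σIdx 0 A ✶ σIdx 2 B ++ σIdx 1 A ✶ σIdx 1 B) ++ σIdx 2 A ✶ σIdx 0 B)
      ≈⟨ ·-cong s (σ₂-leibniz-σIdx A B) ⟩
    s · σ 2 (σIdx 0 A ✶ σIdx 0 B)
      ≈⟨ ·-homo (σ-linear 2) s (σIdx 0 A ✶ σIdx 0 B) ⟨
    σ 2 (s · (σIdx 0 A ✶ σIdx 0 B))
      ∎
    where
    s = sgn (sum (drop i ks))
    A = take i ks
    B = reverse (drop i ks)

lemma2p3 : (ks : List ℕ) → All (1 ≤_) ks → 2 ∣ sum ks →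
    (I 2 ks ++ mIn 1 1 ks) ++ I 2 (reverse ks) ≈ σ 2 (I 0 ks)
lemma2p3 ks _ 2∣Σks = coeff-≡ (begin
  (I 2 ks ++ mIn 1 1 ks) ++ I 2 (reverse ks)  ≈⟨ ++-cong ≋-refl (mIn-reverse 0 2 ks 2∣Σks) ⟩
  (I 2 ks ++ mIn 1 1 ks) ++ mIn 2 0 ks        ≈⟨ mIn-σ₂ ks ⟩
  σ 2 (I 0 ks)                                ∎)
  where open ≋-Reasoning
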